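{- Let $\mathcal{V}=\langle\Sigma_{rdz},S,R\rangle$ be a CVRS and $c,c_1,c_2\in\mathbb{Q}_{\ge0}^S$ configurations. (1) If $c_1$ and $c_2$ are both reachable from $c$, then there is a configuration $c_3$ reachable from $c$ with $\mathrm{supp}(c_3)=\mathrm{supp}(c_1)\cup\mathrm{supp}(c_2)$. (2) If $c$ is reachable from both $c_1$ and $c_2$, then there is a configuration $c_3$ from which $c$ is reachable with $\mathrm{supp}(c_3)=\mathrm{supp}(c_1)\cup\mathrm{supp}(c_2)$.
   Context: Fix $k\ge1$, a finite set $\Sigma_{actn}$ of actions and $\Sigma_{rdz}=\{a_1,\dots,a_k:a\in\Sigma_{actn}\}$. A CVRS is $\mathcal{V}=\langle\Sigma_{rdz},S,R\rangle$ with finite state set $S$ and finite transition set $R\subseteq S\times\Sigma_{rdz}\times S$. Configurations are vectors in $\mathbb{Q}_{\ge0}^S$, compared pointwise. For $t=(p,\sigma,q)$, $\mathrm{out}(t)$ and $\mathrm{in}(t)$ are the unit vectors at $p$ and $q$. A step with multiplicity $\alpha\in\mathbb{Q}_{>0}$ from $c$ to $c'$ using $(t_1,\dots,t_k)\in R^k$ requires some $a\in\Sigma_{actn}$ with $t_i$ labeled $a_i$ for all $i$, $c\ge\alpha\sum_i\mathrm{out}(t_i)$, and $c'=c+\alpha\sum_i(\mathrm{in}(t_i)-\mathrm{out}(t_i))$. A trace is a finite sequence of consecutive steps; $c'$ is reachable from $c$ if a trace leads from $c$ to $c'$. The support is $\mathrm{supp}(c)=\{s\in S:c(s)>0\}$.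 -}

module Defs where

open import Data.Nat using (ℕ; suc)
open import Data.Fin using (Fin; _≟_)
open import Data.Rational using (ℚ; 0ℚ; 1ℚ; _≤_; _<_; _+_; _-_; _*_)
open import Data.List using (List)
open import Data.List.Membership.Propositional using (_∈_)
open import Data.Product using (_×_; _,_; Σ; ∃; ∃-syntax; proj₁; proj₂)
open import Relation.Nullary using (¬_; does)
open import Data.Bool using (if_then_else_)
open import Data.Sum using (_⊎_)
open import Relation.Binary.PropositionalEquality using (_≡_)

-- Rendezvous label a_i : an action a ∈ Fin nActs and an index i ∈ Fin k.
Label : ℕ → ℕ → Set
Label nActs k = Fin nActs × Fin k

record CVRS (k nActs : ℕ) : Set where
  field
    nS : ℕ
    R  : List (Fin nS × Label nActs k × Fin nS)

module _ {k nActs : ℕ} (V : CVRS k nActs) where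
  open CVRS V

  State : Set
  State = Fin nS

  Trans : Set
  Trans = State × Label nActs k × State

  -- configurations: vectors in ℚ^S (nonnegativity stated separately)
  Config : Set
  Config = State → ℚ

  IsConfig : Config → Set
  IsConfig c = ∀ s → 0ℚ ≤ c s

  unit : State → Config
  unit p s = if does (p ≟ s) then 1ℚ else 0ℚ

  out : Trans → Config
  out (p , _ , _) = unit p

  inn : Trans → Config
  inn (_ , _ , q) = unit q

  sumFin : ∀ {m} → (Fin m → Config) → Config
  sumFin {ℕ.zero} f s = 0ℚ
  sumFin {suc m} f s = f Fin.zero s + sumFin (λ i → f (Fin.suc i)) s

  record Step (c c' : Config) : Set where
    field
      α      : ℚ
      α-pos  : 0ℚ < α
      ts     : Fin k → Trans
      ts∈R   : ∀ i → ts i ∈ R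
      act    : Fin nActs
      labels : ∀ i → proj₁ (proj₂ (ts i)) ≡ (act , i)
      enough : ∀ s → α * sumFin (λ i → out (ts i)) s ≤ c s
      result : ∀ s → c' s ≡ c s + α * (sumFin (λ i → inn (ts i)) s - sumFin (λ i → out (ts i)) s)

  data Reach : Config → Config → Set where
    done : ∀ {c} → Reach c c
    step : ∀ {c c' c''} → Step c c' → Reach c' c'' → Reach c c''

  InSupp : Config → State → Set
  InSupp c s = 0ℚ < c s

  SuppUnion : Config → Config → Config → Set
  SuppUnion c₃ c₁ c₂ = ∀ s → (InSupp c₃ s → (InSupp c₁ s ⊎ InSupp c₂ s)) × ((InSupp c₁ s ⊎ InSupp c₂ s) → InSupp c₃ s)

module Submission where

open import Defs
open import Data.Nat using (ℕ; suc)
open import Data.Product using (_×_; ∃-syntax; _,_)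
open import Data.Sum using (_⊎_; inj₁; inj₂)
open import Data.Rational
  using (ℚ; 0ℚ; ½; _≤_; _<_; _+_; _-_; _*_; Positive; positive)
open import Data.Rational.Properties
open import Data.Rational.Solver using (module +-*-Solver)
open import Relation.Binary.PropositionalEquality
open import Relation.Nullary using (yes; no)
open import Data.Empty using (⊥-elim)

-- Reachability is invariant under the affine maps c ↦ a·c + d with a > 0 and
-- d ≥ 0: each step is rescaled by a and the extra mass d is never touched.
-- For (1), run c = ½c + ½c ⇝ ½c₁ + ½c along the first trace and then
-- ½c₁ + ½c ⇝ ½c₁ + ½c₂ along the second; for (2), run both traces backwards
-- from c in the same way.  The midpoint ½c₁ + ½c₂ has support supp c₁ ∪ supp c₂.

scale-pos : ∀ a .{{_ : Positive a}} {x} → 0ℚ < x → 0ℚ < a * x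
scale-pos a {x} 0<x = positive⁻¹ (a * x) {{pos*pos⇒pos a x {{positive 0<x}}}}

scale-nonNeg : ∀ a .{{_ : Positive a}} {x} → 0ℚ ≤ x → 0ℚ ≤ a * x
scale-nonNeg a {x} 0≤x =
  subst (_≤ a * x) (*-zeroʳ a) (*-monoˡ-≤-nonNeg a {{pos⇒nonNeg a}} 0≤x)

scale-nonPos : ∀ a .{{_ : Positive a}} {x} → x ≤ 0ℚ → a * x ≤ 0ℚ
scale-nonPos a {x} x≤0 =
  subst (a * x ≤_) (*-zeroʳ a) (*-monoˡ-≤-nonNeg a {{pos⇒nonNeg a}} x≤0)

½+½ : ∀ x → ½ * x + ½ * x ≡ x
½+½ x = trans (sym (*-distribʳ-+ x ½ ½)) (*-identityˡ x)

module _ {k nActs : ℕ} (V : CVRS k nActs) where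

  infix 4 _≈_
  infixl 6 _+ᶜ_
  infixl 7 _·ᶜ_

  _≈_ : Config V → Config V → Set
  x ≈ y = ∀ s → x s ≡ y s

  _·ᶜ_ : ℚ → Config V → Config V
  (a ·ᶜ c) s = a * c s

  _+ᶜ_ : Config V → Config V → Config V
  (c +ᶜ d) s = c s + d s

  Step-resp-≈ : ∀ {x x' y y'} → x ≈ x' → y ≈ y' → Step V x y → Step V x' y'
  Step-resp-≈ x≈x' y≈y' st = record
    { α = α ; α-pos = α-pos ; ts = ts ; ts∈R = ts∈R ; act = act ; labels = labels
    ; enough = λ s → subst (_ ≤_) (x≈x' s) (enough s)
    ; result = λ s → trans (sym (y≈y' s)) (trans (result s) (cong (_+ _) (x≈x' s)))
    }
    where open Step st

  Reach-trans : ∀ {x y z} → Reach V x y → Reach V y z → Reach V x z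
  Reach-trans done        r' = r'
  Reach-trans (step st r) r' = step st (Reach-trans r r')

  -- Without function extensionality, Reach does not respect ≈ at both ends
  -- (consider done); it does so at one end if the other end may move within ≈.
  Reach-≈-source : ∀ {x x' y} → x ≈ x' → Reach V x y → ∃[ y' ] (y' ≈ y × Reach V x' y')
  Reach-≈-source {x' = x'} x≈x' done = x' , (λ s → sym (x≈x' s)) , done
  Reach-≈-source x≈x' (step st r) = _ , (λ s → refl) , step (Step-resp-≈ x≈x' (λ s → refl) st) r

  Reach-≈-target : ∀ {x y y'} → y ≈ y' → Reach V x y → ∃[ x' ] (x' ≈ x × Reach V x' y')
  Reach-≈-target {y' = y'} y≈y' done = y' , (λ s → sym (y≈y' s)) , done
  Reach-≈-target y≈y' (step st r) with Reach-≈-target y≈y' r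
  ... | _ , z'≈z , r' = _ , (λ s → refl) , step (Step-resp-≈ (λ s → refl) (λ s → sym (z'≈z s)) st) r'

  Step-affine : ∀ a .{{_ : Positive a}} {d c c'} → IsConfig V d
              → Step V c c' → Step V (a ·ᶜ c +ᶜ d) (a ·ᶜ c' +ᶜ d)
  Step-affine a {d} {c} d≥0 st = record
    { α = a * α
    ; α-pos = scale-pos a α-pos
    ; ts = ts ; ts∈R = ts∈R ; act = act ; labels = labels
    ; enough = λ s → begin
        a * α * O s      ≡⟨ *-assoc a α (O s) ⟩
        a * (α * O s)    ≤⟨ *-monoˡ-≤-nonNeg a {{pos⇒nonNeg a}} (enough s) ⟩
        a * c s          ≤⟨ ≤-reflexive (sym (+-identityʳ (a * c s))) ⟩
        a * c s + 0ℚ     ≤⟨ +-monoʳ-≤ (a * c s) (d≥0 s) ⟩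
        a * c s + d s    ∎
    ; result = λ s → trans (cong (λ v → a * v + d s) (result s))
                           (distribute a (c s) α (I s - O s) (d s))
    }
    where
    open Step st
    open ≤-Reasoning
    O I : Config V
    O = sumFin V (λ i → out V (ts i))
    I = sumFin V (λ i → inn V (ts i))
    distribute : ∀ a c α X d → a * (c + α * X) + d ≡ (a * c + d) + (a * α) * X
    distribute = solve 5 (λ a c α X d → a :* (c :+ α :* X) :+ d := (a :* c :+ d) :+ (a :* α) :* X) refl
      where open +-*-Solver

  Reach-affine : ∀ a .{{_ : Positive a}} {d c c'} → IsConfig V d
               → Reach V c c' → Reach V (a ·ᶜ c +ᶜ d) (a ·ᶜ c' +ᶜ d)
  Reach-affine a d≥0 done        = done
  Reach-affine a d≥0 (step st r) = step (Step-affine a d≥0 st) (Reach-affine a d≥0 r)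

  IsConfig-·ᶜ : ∀ a .{{_ : Positive a}} {c} → IsConfig V c → IsConfig V (a ·ᶜ c)
  IsConfig-·ᶜ a c≥0 s = scale-nonNeg a (c≥0 s)

  module _ (a b : ℚ) .{{_ : Positive a}} .{{_ : Positive b}}
           {c₁ c₂ : Config V} (c₁≥0 : IsConfig V c₁) (c₂≥0 : IsConfig V c₂) where

    IsConfig-combination : ∀ {c₃} → c₃ ≈ a ·ᶜ c₁ +ᶜ b ·ᶜ c₂ → IsConfig V c₃
    IsConfig-combination c₃≈ s =
      subst (0ℚ ≤_) (sym (c₃≈ s)) (+-mono-≤ (scale-nonNeg a (c₁≥0 s)) (scale-nonNeg b (c₂≥0 s)))

    SuppUnion-combination : ∀ {c₃} → c₃ ≈ a ·ᶜ c₁ +ᶜ b ·ᶜ c₂ → SuppUnion V c₃ c₁ c₂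
    SuppUnion-combination {c₃} c₃≈ s = ⊆-union , union-⊆
      where
      union-⊆ : InSupp V c₁ s ⊎ InSupp V c₂ s → InSupp V c₃ s
      union-⊆ (inj₁ p) = subst (0ℚ <_) (sym (c₃≈ s))
        (+-mono-<-≤ (scale-pos a p) (scale-nonNeg b (c₂≥0 s)))
      union-⊆ (inj₂ q) = subst (0ℚ <_) (sym (c₃≈ s))
        (+-mono-≤-< (scale-nonNeg a (c₁≥0 s)) (scale-pos b q))

      ⊆-union : InSupp V c₃ s → InSupp V c₁ s ⊎ InSupp V c₂ s
      ⊆-union c₃>0 with 0ℚ <? c₁ s | 0ℚ <? c₂ s
      ... | yes p | _     = inj₁ p
      ... | no _  | yes q = inj₂ q
      ... | no p  | no q  = ⊥-elim (<-irrefl refl (<-≤-trans (subst (0ℚ <_) (c₃≈ s) c₃>0)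
            (+-mono-≤ (scale-nonPos a (≮⇒≥ p)) (scale-nonPos b (≮⇒≥ q)))))

  midpoint-forward : ∀ {c c₁ c₂} → IsConfig V c → IsConfig V c₁
                   → Reach V c c₁ → Reach V c c₂
                   → ∃[ c₃ ] (c₃ ≈ ½ ·ᶜ c₁ +ᶜ ½ ·ᶜ c₂ × Reach V c c₃)
  midpoint-forward {c} {c₁} {c₂} c≥0 c₁≥0 r₁ r₂
    with Reach-≈-source (λ s → ½+½ (c s)) (Reach-affine ½ (IsConfig-·ᶜ ½ c≥0) r₁)
  ... | m , m≈ , c⇝m
    with Reach-≈-source (λ s → trans (+-comm (½ * c s) (½ * c₁ s)) (sym (m≈ s)))
                        (Reach-affine ½ (IsConfig-·ᶜ ½ c₁≥0) r₂)
  ... | c₃ , c₃≈ , m⇝c₃ =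
    c₃ , (λ s → trans (c₃≈ s) (+-comm (½ * c₂ s) (½ * c₁ s))) , Reach-trans c⇝m m⇝c₃

  midpoint-backward : ∀ {c c₁ c₂} → IsConfig V c → IsConfig V c₂
                    → Reach V c₁ c → Reach V c₂ c
                    → ∃[ c₃ ] (c₃ ≈ ½ ·ᶜ c₁ +ᶜ ½ ·ᶜ c₂ × Reach V c₃ c)
  midpoint-backward {c} {c₁} {c₂} c≥0 c₂≥0 r₁ r₂
    with Reach-≈-target (λ s → ½+½ (c s)) (Reach-affine ½ (IsConfig-·ᶜ ½ c≥0) r₂)
  ... | m , m≈ , m⇝c
    with Reach-≈-target (λ s → trans (+-comm (½ * c s) (½ * c₂ s)) (sym (m≈ s)))
                        (Reach-affine ½ (IsConfig-·ᶜ ½ c₂≥0) r₁)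
  ... | c₃ , c₃≈ , c₃⇝m = c₃ , c₃≈ , Reach-trans c₃⇝m m⇝c

lemma7p17 : ∀ {k' nActs : ℕ} (V : CVRS (suc k') nActs)
    → ((c c₁ c₂ : Config V) → IsConfig V c → IsConfig V c₁ → IsConfig V c₂
    → Reach V c c₁ → Reach V c c₂
    → ∃[ c₃ ] (IsConfig V c₃ × Reach V c c₃ × SuppUnion V c₃ c₁ c₂))
    × ((c c₁ c₂ : Config V) → IsConfig V c → IsConfig V c₁ → IsConfig V c₂
    → Reach V c₁ c → Reach V c₂ c
    → ∃[ c₃ ] (IsConfig V c₃ × Reach V c₃ c × SuppUnion V c₃ c₁ c₂))
lemma7p17 V =
  (λ c c₁ c₂ c≥0 c₁≥0 c₂≥0 r₁ r₂ →
    let (c₃ , c₃≈ , c⇝c₃) = midpoint-forward V c≥0 c₁≥0 r₁ r₂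
    in  c₃ , IsConfig-combination V ½ ½ c₁≥0 c₂≥0 c₃≈ , c⇝c₃
           , SuppUnion-combination V ½ ½ c₁≥0 c₂≥0 c₃≈) ,
  (λ c c₁ c₂ c≥0 c₁≥0 c₂≥0 r₁ r₂ →
    let (c₃ , c₃≈ , c₃⇝c) = midpoint-backward V c≥0 c₂≥0 r₁ r₂
    in  c₃ , IsConfig-combination V ½ ½ c₁≥0 c₂≥0 c₃≈ , c₃⇝c
           , SuppUnion-combination V ½ ½ c₁≥0 c₂≥0 c₃≈)
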